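{- Let $k\ge 1$ and let $G$ be a graph that contains $Q_k$ as an induced subgraph. Let $\{N_1,\dots,N_{4k}\}$ be a set of $4k$ pairwise disjoint perfect matchings of $G$ and let $N=\bigcup_{i=1}^{4k}N_i$. If $\partial_G(V(Q_k))=E_k^1\cup E_k^2$, where $E_k^i=[v_1^i,V(G)\setminus V(Q_k)]_G$ for $i\in\{1,2\}$, then $|E_k^1\cap N|=|E_k^2\cap N|=2k$.
   Context: Graphs are finite, may have parallel edges, but no loops. $[U,W]_G$ is the set of edges with one end in $U$ and the other in $W$; $\partial_G(X)=[X,V(G)\setminus X]_G$; $[u,W]_G=[\{u\},W]_G$. Let $P$ be the Petersen graph with two disjoint $5$-circuits $v_1v_2v_3v_4v_5v_1$ and $u_1u_3u_5u_2u_4u_1$ and edges $u_iv_i$ for $i\in\{1,\dots,5\}$. Let $M_0=\{u_iv_i: 1\le i\le 5\}$ and for $i\in\{1,\dots,5\}$ let $M_i$ be the unique perfect matching of $P$ other than $M_0$ containing $u_iv_i$. For a multiset of perfect matchings, $P+\sum N_j$ adds a new parallel copy of every edge of each $N_j$. Let $P_k=P+k(M_0+M_1+M_2)+(k-1)M_5$ (a $(4k+2)$-regular graph in which $u_1$ and $v_1$ are joined by $2k+1$ parallel edges). Take two disjoint copies $P_k^1,P_k^2$ of $P_k$, writing $w^i$ for the copy of $w$ in $P_k^i$. $Q_k$ is obtained by deleting, for each $i\in\{1,2\}$, the $2k+1$ parallel edges between $u_1^i$ and $v_1^i$ in $P_k^i$, and identifying $u_1^1$ and $u_1^2$ into a single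 new vertex. -}

module Defs where

open import Data.Nat using (ℕ; zero; suc; _+_; _∸_)
open import Data.Bool using (Bool; true; false; _∧_; _∨_; not; _xor_; if_then_else_)
open import Data.Fin using (Fin; zero; suc; _≟_)
open import Data.Fin.Subset using (Subset; _∈_)
open import Data.List as List using (List; []; _∷_; _++_; concat; replicate; map; filter)
open import Data.Vec as Vec using ()
open import Data.Bool.ListAction using (any)
open import Data.Product using (_×_; _,_; proj₁; proj₂)
open import Relation.Nullary.Decidable using (⌊_⌋)
open import Relation.Binary.PropositionalEquality using (_≡_; _≢_)

-- Finite loopless multigraphs: vertices Fin nV, edges Fin nE (so parallel
-- edges are distinct edge names with the same ends).

record Graph : Set where
  field
    nV nE    : ℕ
    end₁     : Fin nE → Fin nV
    end₂     : Fin nE → Fin nV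
    loopless : ∀ e → end₁ e ≢ end₂ e
open Graph public

_==_ : ∀ {n} → Fin n → Fin n → Bool
a == b = ⌊ a ≟ b ⌋

joins : (G : Graph) → Fin (nE G) → Fin (nV G) → Fin (nV G) → Bool
joins G e a b = (end₁ G e == a ∧ end₂ G e == b) ∨ (end₁ G e == b ∧ end₂ G e == a)

multG : (G : Graph) → Fin (nV G) → Fin (nV G) → ℕ
multG G a b = Data.Fin.Subset.∣ Vec.tabulate (λ e → joins G e a b) ∣

incident : (G : Graph) → Fin (nV G) → Subset (nE G)
incident G w = Vec.tabulate (λ e → end₁ G e == w ∨ end₂ G e == w)

IsPerfectMatching : (G : Graph) → Subset (nE G) → Set
IsPerfectMatching G M =
  ∀ w → Data.Fin.Subset.∣ Data.Fin.Subset._∩_ M (incident G w) ∣ ≡ 1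

boundary : (G : Graph) → Subset (nV G) → Subset (nE G)
boundary G X = Vec.tabulate (λ e → Vec.lookup X (end₁ G e) xor Vec.lookup X (end₂ G e))

starOut : (G : Graph) → Fin (nV G) → Subset (nV G) → Subset (nE G)
starOut G w X = Vec.tabulate (λ e →
  (end₁ G e == w ∧ not (Vec.lookup X (end₂ G e))) ∨
  (end₂ G e == w ∧ not (Vec.lookup X (end₁ G e))))

-- Petersen graph. Paper index i ∈ {1..5} is represented by (i-1) : Fin 5,
-- so u zero = u₁, v (suc zero) = v₂, ...

data PV : Set where
  u v : Fin 5 → PV

next : Fin 5 → Fin 5
next zero = suc zero
next (suc zero) = suc (suc zero)
next (suc (suc zero)) = suc (suc (suc zero))
next (suc (suc (suc zero))) = suc (suc (suc (suc zero)))
next (suc (suc (suc (suc zero)))) = zero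

_⊕_ : Fin 5 → ℕ → Fin 5
a ⊕ zero = a
a ⊕ suc n = next (a ⊕ n)

_==P_ : PV → PV → Bool
u a ==P u b = a == b
v a ==P v b = a == b
_ ==P _ = false

Edge : Set → Set
Edge V = V × V

all5 : List (Fin 5)
all5 = List.allFin 5

M₀ : List (Edge PV)
M₀ = map (λ i → u i , v i) all5

Pedges : List (Edge PV)
Pedges = map (λ i → v i , v (i ⊕ 1)) all5
      ++ map (λ i → u i , u (i ⊕ 2)) all5
      ++ M₀

-- Mᵢ : the perfect matching ≠ M₀ containing uᵢvᵢ (listed explicitly):
-- {uᵢvᵢ, vᵢ₊₁vᵢ₊₂, vᵢ₊₃vᵢ₊₄, uᵢ₊₂uᵢ₊₄, uᵢ₊₁uᵢ₊₃} (indices mod 5)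
Mi : Fin 5 → List (Edge PV)
Mi i = (u i , v i) ∷ (v (i ⊕ 1) , v (i ⊕ 2)) ∷ (v (i ⊕ 3) , v (i ⊕ 4))
     ∷ (u (i ⊕ 2) , u (i ⊕ 4)) ∷ (u (i ⊕ 1) , u (i ⊕ 3)) ∷ []

i₁ i₂ i₅ : Fin 5
i₁ = zero
i₂ = suc zero
i₅ = suc (suc (suc (suc zero)))

PkEdges : ℕ → List (Edge PV)
PkEdges k = Pedges
         ++ concat (replicate k (M₀ ++ Mi i₁ ++ Mi i₂))
         ++ concat (replicate (k ∸ 1) (Mi i₅))

-- Q_k. Vertices: hub (= identified u₁¹ = u₁²), vv c a (= v_{a+1}^{c+1}),
-- uu c j (= u_{j+2}^{c+1}).

data QV : Set where
  hub : QV
  vv  : Fin 2 → Fin 5 → QV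
  uu  : Fin 2 → Fin 4 → QV

toQ : Fin 2 → PV → QV
toQ c (u zero)    = hub
toQ c (u (suc j)) = uu c j
toQ c (v a)       = vv c a

allQV : List QV
allQV = hub ∷ concat (map (λ c → map (vv c) (List.allFin 5) ++ map (uu c) (List.allFin 4))
                           (List.allFin 2))

_==Q_ : QV → QV → Bool
hub ==Q hub = true
vv c a ==Q vv d b = c == d ∧ a == b
uu c a ==Q uu d b = c == d ∧ a == b
_ ==Q _ = false

isU₁V₁ : Edge PV → Bool
isU₁V₁ (x , y) = (x ==P u zero ∧ y ==P v zero) ∨ (x ==P v zero ∧ y ==P u zero)

-- delete the u₁v₁ edges in each copy, then identify u₁¹ and u₁²
QkEdges : ℕ → List (Edge QV)
QkEdges k = concat (map (λ c → map (λ e → toQ c (proj₁ e) , toQ c (proj₂ e))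
                                   (filter (λ e → not (isU₁V₁ e) Data.Bool.≟ true) (PkEdges k)))
                        (List.allFin 2))

countPairs : List (Edge QV) → QV → QV → ℕ
countPairs [] x y = 0
countPairs ((a , b) ∷ es) x y =
  (if (a ==Q x ∧ b ==Q y) ∨ (a ==Q y ∧ b ==Q x) then 1 else 0) + countPairs es x y

multQ : ℕ → QV → QV → ℕ
multQ k = countPairs (QkEdges k)

InducedQ : ℕ → (G : Graph) → (QV → Fin (nV G)) → Set
InducedQ k G φ = (∀ x y → φ x ≡ φ y → x ≡ y)
               × (∀ x y → multG G (φ x) (φ y) ≡ multQ k x y)

imageQ : (G : Graph) → (QV → Fin (nV G)) → Subset (nV G)
imageQ G φ = Vec.tabulate (λ w → any (λ x → φ x == w) allQV)

-- By the boundary hypothesis every vertex of X = V(Q_k) other than v₁¹ and v₁² has all its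
-- G-edges inside Q_k. Hence a perfect matching N_j of G covers, inside each copy of P_k − u₁v₁,
-- the vertices v₂,…,v₅,u₂,…,u₅ exactly once, v₁ exactly once if edges leaving X at v₁ are counted,
-- and the identified vertex u₁ at most once. A copy has nine vertices besides u₁, so by parity N_j
-- leaves X at v₁ⁱ exactly when it matches u₁ into the other copy. Every N_j matches u₁ into exactly
-- one copy, so it remains to see that no copy receives u₁ from more than 2k of the matchings.
-- A matching entering a copy by u₁u₃ or u₁u₄ covers v₁ by v₁v₂ or v₁v₅; the two mixed combinations
-- force u₂u₅ and the other two force v₃v₄. Comparing the four counts with the multiplicities
-- k, k + 1, k, k + 1, 1 and 2k of u₁u₃, u₁u₄, v₁v₂, v₁v₅, u₂u₅ and v₃v₄ gives the bound 2k.

module Submission where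

open import Defs

open import Data.Bool using (Bool; true; false; _∧_; _∨_; not; _xor_; if_then_else_)
import Data.Bool as Bool
open import Data.Bool.ListAction using (any)
open import Data.Bool.Properties using (∨-comm; ∧-zeroʳ; ∧-identityʳ; ∨-identityʳ)
open import Data.Empty using (⊥-elim)
open import Data.Fin using (Fin; zero; suc; _≟_)
open import Data.Fin.Patterns using (0F; 1F; 2F; 3F; 4F)
import Data.Fin.Properties as Finₚ
open import Data.Fin.Subset using (Subset; _∈_; _∉_; _∩_; _∪_; ⋃; ∣_∣)
open import Data.Fin.Subset.Properties using (∩-comm; ∣p∩q∣≤∣q∣)
open import Data.List using (List; []; _∷_; _++_; map; filter; filterᵇ; concat; replicate; tabulate)
open import Data.List.Properties using (map-cong; map-++; filter-++)
open import Data.Nat using (ℕ; zero; suc; _+_; _*_; _∸_; _≤_; _<_; _<ᵇ_; z≤n; s≤s)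
import Data.Nat.ListAction as ListSum
open import Data.Nat.Properties
  using (+-assoc; +-comm; +-identityʳ; +-cancelʳ-≡; +-cancelʳ-≤; +-mono-≤; +-monoʳ-≤; m≤m+n; m≤n+m;
         m+n≡0⇒m≡0; m+n≡0⇒n≡0; suc-injective; *-zeroʳ; *-identityˡ; *-identityʳ; *-distribˡ-+; *-distribʳ-+;
         *-monoˡ-≤; *-monoʳ-≤; ≤-trans; ≤-reflexive; ≤-antisym; n≤0⇒n≡0; even≢odd;
         module ≤-Reasoning; +-0-commutativeMonoid)
open import Data.Nat.Tactic.RingSolver using (solve-∀)
open import Algebra.Properties.CommutativeMonoid.Sum +-0-commutativeMonoid
  using (sum; sum-syntax; ∑-distrib-+; ∑-comm; sum-cong-≗; sum-replicate-zero)
open import Data.Product using (Σ; _×_; _,_; proj₁; proj₂)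
open import Data.Sum using (_⊎_; inj₁; inj₂)
open import Data.Vec as Vec using (lookup)
open import Data.Vec.Properties using (lookup-zipWith; lookup-replicate; lookup⇒[]=; lookup∘tabulate; tabulate-cong)
open import Function using (_∘_)
open import Relation.Binary.PropositionalEquality
open import Relation.Nullary using (contradiction)
open import Relation.Nullary.Decidable using (⌊_⌋; yes; no)

⟦_⟧ : Bool → ℕ
⟦ true ⟧ = 1
⟦ false ⟧ = 0

⟦x⟧+⟦not-x⟧ : ∀ x → ⟦ x ⟧ + ⟦ not x ⟧ ≡ 1
⟦x⟧+⟦not-x⟧ true  = refl
⟦x⟧+⟦not-x⟧ false = refl

∑-mono-≤ : ∀ {n} {f g : Fin n → ℕ} → (∀ i → f i ≤ g i) → ∑[ i < n ] f i ≤ ∑[ i < n ] g i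
∑-mono-≤ {zero} f≤g = z≤n
∑-mono-≤ {suc n} f≤g = +-mono-≤ (f≤g zero) (∑-mono-≤ (f≤g ∘ suc))

∑-const-1 : ∀ n → ∑[ i < n ] 1 ≡ n
∑-const-1 zero = refl
∑-const-1 (suc n) = cong suc (∑-const-1 n)

term≤∑ : ∀ {n} (f : Fin n → ℕ) i → f i ≤ ∑[ i < n ] f i
term≤∑ f zero = m≤m+n _ _
term≤∑ f (suc i) = ≤-trans (term≤∑ (f ∘ suc) i) (m≤n+m _ _)

∣p∣≡∑ : ∀ {n} (p : Subset n) → ∣ p ∣ ≡ ∑[ i < n ] ⟦ lookup p i ⟧
∣p∣≡∑ Vec.[] = refl
∣p∣≡∑ (true Vec.∷ p) = cong suc (∣p∣≡∑ p)
∣p∣≡∑ (false Vec.∷ p) = ∣p∣≡∑ p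

lookup-∩ : ∀ {n} (p q : Subset n) i → lookup (p ∩ q) i ≡ lookup p i ∧ lookup q i
lookup-∩ p q i = lookup-zipWith _∧_ i p q

∑-sum-comm : ∀ {A : Set} {n} (F : Fin n → A → ℕ) (xs : List A) →
  ∑[ i < n ] ListSum.sum (map (F i) xs) ≡ ListSum.sum (map (λ y → ∑[ i < n ] F i y) xs)
∑-sum-comm {n = n} F [] = sum-replicate-zero n
∑-sum-comm {n = n} F (x ∷ xs) = begin
  ∑[ i < n ] (F i x + ListSum.sum (map (F i) xs))
    ≡⟨ ∑-distrib-+ (λ i → F i x) (λ i → ListSum.sum (map (F i) xs)) ⟩
  ∑[ i < n ] F i x + ∑[ i < n ] ListSum.sum (map (F i) xs)
    ≡⟨ cong (∑[ i < n ] F i x +_) (∑-sum-comm F xs) ⟩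
  ∑[ i < n ] F i x + ListSum.sum (map (λ y → ∑[ i < n ] F i y) xs) ∎
  where open ≡-Reasoning

sum-map-cong : ∀ {A : Set} {f g : A → ℕ} → (∀ x → f x ≡ g x) → ∀ xs →
  ListSum.sum (map f xs) ≡ ListSum.sum (map g xs)
sum-map-cong f≗g xs = cong ListSum.sum (map-cong f≗g xs)

sum-map-zero : ∀ {A : Set} {f : A → ℕ} → (∀ x → f x ≡ 0) → ∀ xs → ListSum.sum (map f xs) ≡ 0
sum-map-zero f≡0 []       = refl
sum-map-zero f≡0 (x ∷ xs) = cong₂ _+_ (f≡0 x) (sum-map-zero f≡0 xs)

sum-map-filterᵇ : ∀ {A : Set} (p : A → Bool) (f : A → ℕ) (xs : List A) →
  (∀ y → p y ≡ false → f y ≡ 0) → ListSum.sum (map f xs) ≡ ListSum.sum (map f (filterᵇ p xs))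
sum-map-filterᵇ p f [] f-vanishes = refl
sum-map-filterᵇ p f (x ∷ xs) f-vanishes with p x in px
... | true  = cong (f x +_) (sum-map-filterᵇ p f xs f-vanishes)
... | false = cong₂ _+_ (f-vanishes x px) (sum-map-filterᵇ p f xs f-vanishes)

∣∩∣≡∑ : ∀ {n} (p q : Subset n) → ∣ p ∩ q ∣ ≡ ∑[ e < n ] ⟦ lookup p e ∧ lookup q e ⟧
∣∩∣≡∑ p q = trans (∣p∣≡∑ (p ∩ q)) (sum-cong-≗ λ e → cong ⟦_⟧ (lookup-∩ p q e))

∑-zero : ∀ {n} {f : Fin n → ℕ} → (∀ i → f i ≡ 0) → ∑[ i < n ] f i ≡ 0
∑-zero {n} f≡0 = trans (sum-cong-≗ f≡0) (sum-replicate-zero n)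

⟦⋃∧⟧≡∑ : ∀ {n} m (Ns : Fin m → Subset n) e →
  (∀ i j → i ≢ j → lookup (Ns i) e ≡ true → lookup (Ns j) e ≡ false) →
  ∀ b → ⟦ lookup (⋃ (tabulate Ns)) e ∧ b ⟧ ≡ ∑[ j < m ] ⟦ lookup (Ns j) e ∧ b ⟧
⟦⋃∧⟧≡∑ zero Ns e _ b rewrite lookup-replicate e false = refl
⟦⋃∧⟧≡∑ (suc m) Ns e disjoint b
  rewrite lookup-zipWith _∨_ e (Ns zero) (⋃ (tabulate (Ns ∘ suc)))
  with lookup (Ns zero) e in e∈N₀
... | true  = sym (trans (cong (⟦ b ⟧ +_) (∑-zero λ j → cong (λ x → ⟦ x ∧ b ⟧) (disjoint zero (suc j) (λ ()) e∈N₀)))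
                        (+-identityʳ ⟦ b ⟧))
... | false = ⟦⋃∧⟧≡∑ m (Ns ∘ suc) e (λ i j i≢j → disjoint (suc i) (suc j) (i≢j ∘ Finₚ.suc-injective)) b

∑∣∩∣-disjoint : ∀ {n m} (Ns : Fin m → Subset n) →
  (∀ i j → i ≢ j → ∀ e → e ∈ Ns i → e ∉ Ns j) →
  ∀ S → ∑[ j < m ] ∣ Ns j ∩ S ∣ ≡ ∣ ⋃ (tabulate Ns) ∩ S ∣
∑∣∩∣-disjoint {n} {m} Ns disjoint S = begin
  ∑[ j < m ] ∣ Ns j ∩ S ∣                            ≡⟨ sum-cong-≗ (λ j → ∣∩∣≡∑ (Ns j) S) ⟩
  ∑[ j < m ] ∑[ e < n ] ⟦ lookup (Ns j) e ∧ lookup S e ⟧ ≡⟨ ∑-comm (λ j e → ⟦ lookup (Ns j) e ∧ lookup S e ⟧) ⟩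
  ∑[ e < n ] ∑[ j < m ] ⟦ lookup (Ns j) e ∧ lookup S e ⟧
    ≡⟨ sum-cong-≗ (λ e → sym (⟦⋃∧⟧≡∑ m Ns e (disjointᵇ e) (lookup S e))) ⟩
  ∑[ e < n ] ⟦ lookup (⋃ (tabulate Ns)) e ∧ lookup S e ⟧ ≡⟨ sym (∣∩∣≡∑ (⋃ (tabulate Ns)) S) ⟩
  ∣ ⋃ (tabulate Ns) ∩ S ∣ ∎
  where
  open ≡-Reasoning
  disjointᵇ : ∀ e i j → i ≢ j → lookup (Ns i) e ≡ true → lookup (Ns j) e ≡ false
  disjointᵇ e i j i≢j e∈i with lookup (Ns j) e in e∈j
  ... | false = refl
  ... | true  = ⊥-elim (disjoint i j i≢j e (lookup⇒[]= e (Ns i) e∈i) (lookup⇒[]= e (Ns j) e∈j))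

any-witness : ∀ {A : Set} (p : A → Bool) xs → any p xs ≡ true → Σ A (λ x → p x ≡ true)
any-witness p (x ∷ xs) any≡true with p x in px
... | true  = x , px
... | false = any-witness p xs any≡true

any-from-sum : ∀ {A : Set} (p : A → Bool) xs → 0 < ListSum.sum (map (λ x → ⟦ p x ⟧) xs) → any p xs ≡ true
any-from-sum p (x ∷ xs) 0<sum with p x
... | true  = refl
... | false = any-from-sum p xs 0<sum

==-sound : ∀ {n} {a b : Fin n} → a == b ≡ true → a ≡ b
==-sound {a = a} {b} a==b with a ≟ b
... | yes a≡b = a≡b

==-refl : ∀ {n} (a : Fin n) → ⌊ a ≟ a ⌋ ≡ true
==-refl a with a ≟ a
... | yes _   = refl
... | no  a≢a = ⊥-elim (a≢a refl)

==-comm : ∀ {n} (a b : Fin n) → ⌊ a ≟ b ⌋ ≡ ⌊ b ≟ a ⌋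
==-comm a b with a ≟ b | b ≟ a
... | yes _   | yes _   = refl
... | no  _   | no  _   = refl
... | yes a≡b | no  b≢a = ⊥-elim (b≢a (sym a≡b))
... | no  a≢b | yes b≡a = ⊥-elim (a≢b (sym b≡a))

==Q-sound : ∀ x y → x ==Q y ≡ true → x ≡ y
==Q-sound hub      hub      _  = refl
==Q-sound (vv c a) (vv d b) eq with c == d in c≡d | a == b in a≡b
... | true | true = cong₂ vv (==-sound c≡d) (==-sound a≡b)
==Q-sound (uu c a) (uu d b) eq with c == d in c≡d | a == b in a≡b
... | true | true = cong₂ uu (==-sound c≡d) (==-sound a≡b)

==Q-refl : ∀ x → x ==Q x ≡ true
==Q-refl hub      = refl
==Q-refl (vv c a) = cong₂ _∧_ (==-refl c) (==-refl a)
==Q-refl (uu c a) = cong₂ _∧_ (==-refl c) (==-refl a)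

allQV-count : ∀ x → ListSum.sum (map (λ y → ⟦ x ==Q y ⟧) allQV) ≡ 1
allQV-count hub        = refl
allQV-count (vv 0F 0F) = refl
allQV-count (vv 0F 1F) = refl
allQV-count (vv 0F 2F) = refl
allQV-count (vv 0F 3F) = refl
allQV-count (vv 0F 4F) = refl
allQV-count (vv 1F 0F) = refl
allQV-count (vv 1F 1F) = refl
allQV-count (vv 1F 2F) = refl
allQV-count (vv 1F 3F) = refl
allQV-count (vv 1F 4F) = refl
allQV-count (uu 0F 0F) = refl
allQV-count (uu 0F 1F) = refl
allQV-count (uu 0F 2F) = refl
allQV-count (uu 0F 3F) = refl
allQV-count (uu 1F 0F) = refl
allQV-count (uu 1F 1F) = refl
allQV-count (uu 1F 2F) = refl
allQV-count (uu 1F 3F) = refl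

-- The vertex set of Q_k inside G

edgesBetween : (G : Graph) → Fin (nV G) → Fin (nV G) → Subset (nE G)
edgesBetween G a b = Vec.tabulate (λ e → joins G e a b)

∣∩edgesBetween∣-comm : ∀ (G : Graph) M a b → ∣ M ∩ edgesBetween G a b ∣ ≡ ∣ M ∩ edgesBetween G b a ∣
∣∩edgesBetween∣-comm G M a b =
  cong (λ E → ∣ M ∩ E ∣) (tabulate-cong λ e → ∨-comm (end₁ G e == a ∧ end₂ G e == b) (end₁ G e == b ∧ end₂ G e == a))

module Embedding (G : Graph) (φ : QV → Fin (nV G)) (φ-injective : ∀ x y → φ x ≡ φ y → x ≡ y) where

  X : Subset (nV G)
  X = imageQ G φ

  φ==φ : ∀ x y → (φ x == φ y) ≡ (x ==Q y)
  φ==φ x y with x ==Q y in x==y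
  ... | true rewrite ==Q-sound x y x==y = ==-refl (φ y)
  ... | false with φ x == φ y in φx==φy
  ...   | false = refl
  ...   | true with φ-injective x y (==-sound φx==φy)
  ...     | refl with () ← trans (sym x==y) (==Q-refl x)

  φ∈X : ∀ x → lookup X (φ x) ≡ true
  φ∈X x = trans (lookup∘tabulate (λ t → any (λ y → φ y == t) allQV) (φ x))
    (any-from-sum (λ y → φ y == φ x) allQV (≤-reflexive (sym count)))
    where
    count : ListSum.sum (map (λ y → ⟦ φ y == φ x ⟧) allQV) ≡ 1
    count = trans (sum-map-cong (λ y → cong ⟦_⟧ (trans (==-comm (φ y) (φ x)) (φ==φ x y))) allQV) (allQV-count x)

  ∈X⇒image : ∀ t → lookup X t ≡ true → Σ QV (λ y → φ y ≡ t)
  ∈X⇒image t t∈X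
    with any-witness (λ y → φ y == t) allQV (trans (sym (lookup∘tabulate (λ t → any (λ y → φ y == t) allQV) t)) t∈X)
  ... | y , φy==t = y , ==-sound φy==t

  preimage-count : ∀ t → ListSum.sum (map (λ y → ⟦ t == φ y ⟧) allQV) ≡ ⟦ lookup X t ⟧
  preimage-count t with lookup X t in t∈X
  ... | true with ∈X⇒image t t∈X
  ...   | y₀ , refl = trans (sum-map-cong (λ y → cong ⟦_⟧ (φ==φ y₀ y)) allQV) (allQV-count y₀)
  preimage-count t | false = sum-map-zero (λ y → cong ⟦_⟧ (t≢φy y)) allQV
    where
    t≢φy : ∀ y → t == φ y ≡ false
    t≢φy y with t == φ y in t==φy
    ... | false = refl
    ... | true with () ← trans (sym t∈X) (subst (λ t → lookup X t ≡ true) (sym (==-sound t==φy)) (φ∈X y))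

  leaves : (a b w : Fin (nV G)) → Bool
  leaves a b w = (a == w ∧ not (lookup X b)) ∨ (b == w ∧ not (lookup X a))

  incidence-split : ∀ (a b w : Fin (nV G)) → a ≢ b →
    ⟦ a == w ∨ b == w ⟧
      ≡ ListSum.sum (map (λ y → ⟦ (a == w ∧ b == φ y) ∨ (a == φ y ∧ b == w) ⟧) allQV) + ⟦ leaves a b w ⟧
  incidence-split a b w a≢b with a == w in a==w | b == w in b==w
  ... | true  | true  = ⊥-elim (a≢b (trans (==-sound a==w) (sym (==-sound b==w))))
  ... | true  | false = sym (begin
    ListSum.sum (map (λ y → ⟦ b == φ y ∨ (a == φ y ∧ false) ⟧) allQV) + ⟦ not (lookup X b) ∨ false ⟧
      ≡⟨ cong₂ _+_ (sum-map-cong (λ y → cong ⟦_⟧ (trans (cong (b == φ y ∨_) (∧-zeroʳ (a == φ y)))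
                                                          (∨-identityʳ (b == φ y)))) allQV)
                   (cong ⟦_⟧ (∨-identityʳ (not (lookup X b)))) ⟩
    ListSum.sum (map (λ y → ⟦ b == φ y ⟧) allQV) + ⟦ not (lookup X b) ⟧
      ≡⟨ cong (_+ ⟦ not (lookup X b) ⟧) (preimage-count b) ⟩
    ⟦ lookup X b ⟧ + ⟦ not (lookup X b) ⟧
      ≡⟨ ⟦x⟧+⟦not-x⟧ (lookup X b) ⟩
    1 ∎)
    where open ≡-Reasoning
  ... | false | true  = sym (begin
    ListSum.sum (map (λ y → ⟦ a == φ y ∧ true ⟧) allQV) + ⟦ not (lookup X a) ⟧
      ≡⟨ cong (_+ ⟦ not (lookup X a) ⟧) (sum-map-cong (λ y → cong ⟦_⟧ (∧-identityʳ (a == φ y))) allQV) ⟩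
    ListSum.sum (map (λ y → ⟦ a == φ y ⟧) allQV) + ⟦ not (lookup X a) ⟧
      ≡⟨ cong (_+ ⟦ not (lookup X a) ⟧) (preimage-count a) ⟩
    ⟦ lookup X a ⟧ + ⟦ not (lookup X a) ⟧
      ≡⟨ ⟦x⟧+⟦not-x⟧ (lookup X a) ⟩
    1 ∎)
    where open ≡-Reasoning
  ... | false | false = sym (cong (_+ 0) (sum-map-zero (λ y → cong ⟦_⟧ (∧-zeroʳ (a == φ y))) allQV))

  lookup-starOut : ∀ w e → lookup (starOut G w X) e ≡ leaves (end₁ G e) (end₂ G e) w
  lookup-starOut w e = lookup∘tabulate (λ e → leaves (end₁ G e) (end₂ G e) w) e

  degree-split : ∀ M w → ∣ M ∩ incident G w ∣
    ≡ ListSum.sum (map (λ y → ∣ M ∩ edgesBetween G w (φ y) ∣) allQV) + ∣ M ∩ starOut G w X ∣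
  degree-split M w = begin
    ∣ M ∩ incident G w ∣
      ≡⟨ ∣∩∣≡∑ M (incident G w) ⟩
    ∑[ e < nE G ] ⟦ lookup M e ∧ lookup (incident G w) e ⟧
      ≡⟨ sum-cong-≗ split-edge ⟩
    ∑[ e < nE G ] (ListSum.sum (map (towards e) allQV) + away e)
      ≡⟨ ∑-distrib-+ (λ e → ListSum.sum (map (towards e) allQV)) away ⟩
    ∑[ e < nE G ] ListSum.sum (map (towards e) allQV) + ∑[ e < nE G ] away e
      ≡⟨ cong₂ _+_ (trans (∑-sum-comm towards allQV)
                          (sum-map-cong (λ y → sym (∣∩∣≡∑ M (edgesBetween G w (φ y)))) allQV))
                   (sym (∣∩∣≡∑ M (starOut G w X))) ⟩
    ListSum.sum (map (λ y → ∣ M ∩ edgesBetween G w (φ y) ∣) allQV) + ∣ M ∩ starOut G w X ∣ ∎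
    where
    open ≡-Reasoning
    towards : Fin (nE G) → QV → ℕ
    towards e y = ⟦ lookup M e ∧ lookup (edgesBetween G w (φ y)) e ⟧
    away : Fin (nE G) → ℕ
    away e = ⟦ lookup M e ∧ lookup (starOut G w X) e ⟧
    split-edge : ∀ e → ⟦ lookup M e ∧ lookup (incident G w) e ⟧ ≡ ListSum.sum (map (towards e) allQV) + away e
    split-edge e with lookup M e
    ... | false = sym (cong (_+ 0) (sum-map-zero (λ _ → refl) allQV))
    ... | true  = begin
      ⟦ lookup (incident G w) e ⟧
        ≡⟨ cong ⟦_⟧ (lookup∘tabulate (λ e → end₁ G e == w ∨ end₂ G e == w) e) ⟩
      ⟦ end₁ G e == w ∨ end₂ G e == w ⟧
        ≡⟨ incidence-split (end₁ G e) (end₂ G e) w (loopless G e) ⟩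
      ListSum.sum (map (λ y → ⟦ joins G e w (φ y) ⟧) allQV) + ⟦ leaves (end₁ G e) (end₂ G e) w ⟧
        ≡⟨ cong₂ _+_ (sum-map-cong (λ y → cong ⟦_⟧ (sym (lookup∘tabulate (λ e → joins G e w (φ y)) e))) allQV)
                     (cong ⟦_⟧ (sym (lookup-starOut w e))) ⟩
      ListSum.sum (map (λ y → ⟦ lookup (edgesBetween G w (φ y)) e ⟧) allQV) + ⟦ lookup (starOut G w X) e ⟧ ∎

  leaves-by : ∀ (a b w : Fin (nV G)) → b == w ∧ not (lookup X a) ≡ true → b ≡ w × lookup X a ≡ false
  leaves-by a b w with b == w in b==w | lookup X a
  ... | true  | false = λ _ → ==-sound b==w , refl
  ... | true  | true  = λ ()
  ... | false | _     = λ ()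

  leaves-at : ∀ (a b w : Fin (nV G)) → leaves a b w ≡ true →
    (a ≡ w × lookup X b ≡ false) ⊎ (b ≡ w × lookup X a ≡ false)
  leaves-at a b w with a == w in a==w | lookup X b
  ... | true  | false = λ _ → inj₁ (==-sound a==w , refl)
  ... | true  | true  = inj₂ ∘ leaves-by a b w
  ... | false | _     = inj₂ ∘ leaves-by a b w

  leaves-unique : ∀ (a b w w′ : Fin (nV G)) → lookup X w ≡ true → leaves a b w ≡ true → leaves a b w′ ≡ true → w ≡ w′
  leaves-unique a b w w′ w∈X at-w at-w′ with leaves-at a b w at-w | leaves-at a b w′ at-w′
  ... | inj₁ (refl , _) | inj₁ (refl , _) = refl
  ... | inj₂ (refl , _) | inj₂ (refl , _) = refl
  ... | inj₁ (refl , _) | inj₂ (_ , a∉X)  with () ← trans (sym a∉X) w∈X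
  ... | inj₂ (refl , _) | inj₁ (_ , b∉X)  with () ← trans (sym b∉X) w∈X

  leaves⇒crosses : ∀ (a b w : Fin (nV G)) → lookup X w ≡ true → leaves a b w ≡ true → lookup X a xor lookup X b ≡ true
  leaves⇒crosses a b w w∈X at-w with leaves-at a b w at-w
  ... | inj₁ (refl , b∉X) rewrite w∈X | b∉X = refl
  ... | inj₂ (refl , a∉X) rewrite w∈X | a∉X = refl

  starOut-vanishes : ∀ {w₀ w₁} → boundary G X ≡ starOut G w₀ X ∪ starOut G w₁ X →
    ∀ x → φ x ≢ w₀ → φ x ≢ w₁ → ∀ M → ∣ M ∩ starOut G (φ x) X ∣ ≡ 0
  starOut-vanishes {w₀} {w₁} ∂X≡ x φx≢w₀ φx≢w₁ M = trans (∣∩∣≡∑ M (starOut G (φ x) X)) (∑-zero λ e →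
    trans (cong (λ b → ⟦ lookup M e ∧ b ⟧) (trans (lookup-starOut (φ x) e) (stays e)))
          (cong ⟦_⟧ (∧-zeroʳ (lookup M e))))
    where
    crosses⇒leaves-at-w₀-or-w₁ : ∀ e → lookup X (end₁ G e) xor lookup X (end₂ G e) ≡ true →
      leaves (end₁ G e) (end₂ G e) w₀ ∨ leaves (end₁ G e) (end₂ G e) w₁ ≡ true
    crosses⇒leaves-at-w₀-or-w₁ e crosses = begin
      leaves (end₁ G e) (end₂ G e) w₀ ∨ leaves (end₁ G e) (end₂ G e) w₁
        ≡⟨ cong₂ _∨_ (lookup-starOut w₀ e) (lookup-starOut w₁ e) ⟨
      lookup (starOut G w₀ X) e ∨ lookup (starOut G w₁ X) e
        ≡⟨ lookup-zipWith _∨_ e (starOut G w₀ X) (starOut G w₁ X) ⟨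
      lookup (starOut G w₀ X ∪ starOut G w₁ X) e
        ≡⟨ cong (λ S → lookup S e) ∂X≡ ⟨
      lookup (boundary G X) e
        ≡⟨ lookup∘tabulate (λ e → lookup X (end₁ G e) xor lookup X (end₂ G e)) e ⟩
      lookup X (end₁ G e) xor lookup X (end₂ G e)
        ≡⟨ crosses ⟩
      true ∎
      where open ≡-Reasoning
    stays : ∀ e → leaves (end₁ G e) (end₂ G e) (φ x) ≡ false
    stays e with leaves (end₁ G e) (end₂ G e) (φ x) in at-φx
    ... | false = refl
    ... | true with leaves (end₁ G e) (end₂ G e) w₀ in at-w₀
                  | crosses⇒leaves-at-w₀-or-w₁ e (leaves⇒crosses (end₁ G e) (end₂ G e) (φ x) (φ∈X x) at-φx)
    ...   | true  | _     = ⊥-elim (φx≢w₀ (leaves-unique (end₁ G e) (end₂ G e) (φ x) w₀ (φ∈X x) at-φx at-w₀))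
    ...   | false | at-w₁ = ⊥-elim (φx≢w₁ (leaves-unique (end₁ G e) (end₂ G e) (φ x) w₁ (φ∈X x) at-φx at-w₁))

-- Edge counts of a perfect matching of G inside one copy of P_k − u₁v₁, per edge of the Petersen
-- graph: every vertex but u₁ is covered exactly once, where v₁-out counts the edges at v₁ leaving
-- V(Q_k), and u₁, shared by both copies, is covered at most once.
record PetersenMatching : Set where
  field
    u₁u₃ u₁u₄ v₁v₂ v₁v₅ v₂v₃ v₃v₄ v₄v₅ u₂v₂ u₃v₃ u₄v₄ u₅v₅ u₂u₄ u₂u₅ u₃u₅ v₁-out : ℕ
    at-v₁ : v₁v₂ + v₁v₅ + v₁-out ≡ 1
    at-v₂ : v₁v₂ + v₂v₃ + u₂v₂ ≡ 1
    at-v₃ : v₂v₃ + v₃v₄ + u₃v₃ ≡ 1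
    at-v₄ : v₃v₄ + v₄v₅ + u₄v₄ ≡ 1
    at-v₅ : v₁v₅ + v₄v₅ + u₅v₅ ≡ 1
    at-u₂ : u₂v₂ + u₂u₄ + u₂u₅ ≡ 1
    at-u₃ : u₁u₃ + u₃v₃ + u₃u₅ ≡ 1
    at-u₄ : u₁u₄ + u₄v₄ + u₂u₄ ≡ 1
    at-u₅ : u₅v₅ + u₂u₅ + u₃u₅ ≡ 1
    at-u₁ : u₁u₃ + u₁u₄ ≤ 1

  hub-degree : ℕ
  hub-degree = u₁u₃ + u₁u₄

private
  first≡1⇒rest≡0 : ∀ {x y z} → x + y + z ≡ 1 → x ≡ 1 → y ≡ 0 × z ≡ 0
  first≡1⇒rest≡0 {y = y} eq refl = m+n≡0⇒m≡0 y (suc-injective eq) , m+n≡0⇒n≡0 y (suc-injective eq)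

  rest≡0⇒first≡1 : ∀ {x y z} → x + y + z ≡ 1 → y ≡ 0 → z ≡ 0 → x ≡ 1
  rest≡0⇒first≡1 {x} eq refl refl rewrite +-identityʳ x | +-identityʳ x = eq

  rest≡0⇒second≡1 : ∀ {x y z} → x + y + z ≡ 1 → x ≡ 0 → z ≡ 0 → y ≡ 1
  rest≡0⇒second≡1 {y = y} eq refl refl rewrite +-identityʳ y = eq

  rest≡0⇒third≡1 : ∀ {x y z} → x + y + z ≡ 1 → x ≡ 0 → y ≡ 0 → z ≡ 1
  rest≡0⇒third≡1 eq refl refl = eq

  x+y+z≡1⇒x≤1 : ∀ {x y z} → x + y + z ≡ 1 → x ≤ 1
  x+y+z≡1⇒x≤1 {x} {y} {z} eq = ≤-trans (≤-trans (m≤m+n x y) (m≤m+n (x + y) z)) (≤-reflexive eq)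

  x+y+z≡1⇒y≤1 : ∀ {x y z} → x + y + z ≡ 1 → y ≤ 1
  x+y+z≡1⇒y≤1 {x} {y} {z} eq = ≤-trans (≤-trans (m≤n+m y x) (m≤m+n (x + y) z)) (≤-reflexive eq)

  2*n+r≡9⇒r≡1 : ∀ n r → 2 * n + r ≡ 9 → r ≤ 2 → r ≡ 1
  2*n+r≡9⇒r≡1 n 0 eq _ = contradiction (trans (sym (+-identityʳ (2 * n))) eq) (even≢odd n 4)
  2*n+r≡9⇒r≡1 n 1 eq _ = refl
  2*n+r≡9⇒r≡1 n 2 eq _ = contradiction (trans (double-suc n) eq) (even≢odd (suc n) 4)
    where
    double-suc : ∀ n → 2 * suc n ≡ 2 * n + 2
    double-suc = solve-∀
  2*n+r≡9⇒r≡1 n (suc (suc (suc _))) eq (s≤s (s≤s ()))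

  product-bound : ∀ {x x′ y y′ z} → x + x′ ≤ 1 → y ≤ 1 → y′ ≤ 1 →
    (x ≡ 1 → y ≡ 1 → z ≡ 1) → (x′ ≡ 1 → y′ ≡ 1 → z ≡ 1) → x * y + x′ * y′ ≤ z
  product-bound {0} {0} _ _ _ _ _ = z≤n
  product-bound {1} {0} {0} _ _ _ _ _ = z≤n
  product-bound {1} {0} {1} _ _ _ forced _ = ≤-reflexive (sym (forced refl refl))
  product-bound {0} {1} {y′ = 0} _ _ _ _ _ = z≤n
  product-bound {0} {1} {y′ = 1} _ _ _ _ forced = ≤-reflexive (sym (forced refl refl))
  product-bound {1} {1} (s≤s ())
  product-bound {suc (suc _)} (s≤s ())
  product-bound {0} {suc (suc _)} (s≤s ())
  product-bound {1} {0} {suc (suc _)} _ (s≤s ())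
  product-bound {0} {1} {y′ = suc (suc _)} _ _ (s≤s ())

  x*y+x*y′≤x : ∀ x {y y′} → y + y′ ≤ 1 → x * y + x * y′ ≤ x
  x*y+x*y′≤x x {y} {y′} y+y′≤1 = begin
    x * y + x * y′ ≡⟨ *-distribˡ-+ x y y′ ⟨
    x * (y + y′)   ≤⟨ *-monoʳ-≤ x y+y′≤1 ⟩
    x * 1          ≡⟨ *-identityʳ x ⟩
    x              ∎
    where open ≤-Reasoning

  x*y+x′*y≤y : ∀ x x′ y → x + x′ ≤ 1 → x * y + x′ * y ≤ y
  x*y+x′*y≤y x x′ y x+x′≤1 = begin
    x * y + x′ * y ≡⟨ *-distribʳ-+ y x x′ ⟨
    (x + x′) * y   ≤⟨ *-monoˡ-≤ y x+x′≤1 ⟩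
    1 * y          ≡⟨ *-identityˡ y ⟩
    y              ∎
    where open ≤-Reasoning

module _ (R : PetersenMatching) where
  open PetersenMatching R

  -- Summing the nine vertex equations counts u₁u₃, u₁u₄ and v₁-out once and every other edge
  -- twice, so v₁-out + hub-degree is odd.
  hub-or-exit : v₁-out + hub-degree ≡ 1
  hub-or-exit = 2*n+r≡9⇒r≡1 internal (v₁-out + hub-degree) handshake (+-mono-≤ out≤1 at-u₁)
    where
    internal : ℕ
    internal = v₁v₂ + v₁v₅ + v₂v₃ + v₃v₄ + v₄v₅ + u₂v₂ + u₃v₃ + u₄v₄ + u₅v₅ + u₂u₄ + u₂u₅ + u₃u₅
    degree-sum : ∀ v₁v₂ v₁v₅ v₂v₃ v₃v₄ v₄v₅ u₂v₂ u₃v₃ u₄v₄ u₅v₅ u₂u₄ u₂u₅ u₃u₅ u₁u₃ u₁u₄ o →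
      2 * (v₁v₂ + v₁v₅ + v₂v₃ + v₃v₄ + v₄v₅ + u₂v₂ + u₃v₃ + u₄v₄ + u₅v₅ + u₂u₄ + u₂u₅ + u₃u₅) + (o + (u₁u₃ + u₁u₄))
      ≡ (v₁v₂ + v₁v₅ + o) + (v₁v₂ + v₂v₃ + u₂v₂) + (v₂v₃ + v₃v₄ + u₃v₃) + (v₃v₄ + v₄v₅ + u₄v₄)
        + (v₁v₅ + v₄v₅ + u₅v₅) + (u₂v₂ + u₂u₄ + u₂u₅) + (u₁u₃ + u₃v₃ + u₃u₅) + (u₁u₄ + u₄v₄ + u₂u₄)
        + (u₅v₅ + u₂u₅ + u₃u₅)
    degree-sum = solve-∀
    handshake : 2 * internal + (v₁-out + hub-degree) ≡ 9
    handshake = trans (degree-sum v₁v₂ v₁v₅ v₂v₃ v₃v₄ v₄v₅ u₂v₂ u₃v₃ u₄v₄ u₅v₅ u₂u₄ u₂u₅ u₃u₅ u₁u₃ u₁u₄ v₁-out)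
      (cong₂ _+_ (cong₂ _+_ (cong₂ _+_ (cong₂ _+_ (cong₂ _+_ (cong₂ _+_ (cong₂ _+_ (cong₂ _+_
        at-v₁ at-v₂) at-v₃) at-v₄) at-v₅) at-u₂) at-u₃) at-u₄) at-u₅)
    out≤1 : v₁-out ≤ 1
    out≤1 = ≤-trans (m≤n+m v₁-out (v₁v₂ + v₁v₅)) (≤-reflexive at-v₁)

  v₁-follows-hub : v₁v₂ + v₁v₅ ≡ hub-degree
  v₁-follows-hub = +-cancelʳ-≡ v₁-out _ _ (trans at-v₁ (trans (sym hub-or-exit) (+-comm v₁-out hub-degree)))

  crossing-bound : u₁u₃ * v₁v₅ + u₁u₄ * v₁v₂ ≤ u₂u₅
  crossing-bound = product-bound at-u₁ (x+y+z≡1⇒y≤1 {v₁v₂} at-v₁) (x+y+z≡1⇒x≤1 at-v₁) via-u₅ via-u₂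
    where
    via-u₅ : u₁u₃ ≡ 1 → v₁v₅ ≡ 1 → u₂u₅ ≡ 1
    via-u₅ u₁u₃≡1 v₁v₅≡1 with first≡1⇒rest≡0 at-u₃ u₁u₃≡1 | first≡1⇒rest≡0 at-v₅ v₁v₅≡1
    ... | _ , u₃u₅≡0 | _ , u₅v₅≡0 = rest≡0⇒second≡1 at-u₅ u₅v₅≡0 u₃u₅≡0
    via-u₂ : u₁u₄ ≡ 1 → v₁v₂ ≡ 1 → u₂u₅ ≡ 1
    via-u₂ u₁u₄≡1 v₁v₂≡1 with first≡1⇒rest≡0 at-u₄ u₁u₄≡1 | first≡1⇒rest≡0 at-v₂ v₁v₂≡1
    ... | _ , u₂u₄≡0 | _ , u₂v₂≡0 = rest≡0⇒third≡1 at-u₂ u₂v₂≡0 u₂u₄≡0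

  parallel-bound : u₁u₃ * v₁v₂ + u₁u₄ * v₁v₅ ≤ v₃v₄
  parallel-bound = product-bound at-u₁ (x+y+z≡1⇒x≤1 at-v₁) (x+y+z≡1⇒y≤1 {v₁v₂} at-v₁) via-v₃ via-v₄
    where
    via-v₃ : u₁u₃ ≡ 1 → v₁v₂ ≡ 1 → v₃v₄ ≡ 1
    via-v₃ u₁u₃≡1 v₁v₂≡1 with first≡1⇒rest≡0 at-u₃ u₁u₃≡1 | first≡1⇒rest≡0 at-v₂ v₁v₂≡1
    ... | u₃v₃≡0 , _ | v₂v₃≡0 , _ = rest≡0⇒second≡1 at-v₃ v₂v₃≡0 u₃v₃≡0
    via-v₄ : u₁u₄ ≡ 1 → v₁v₅ ≡ 1 → v₃v₄ ≡ 1
    via-v₄ u₁u₄≡1 v₁v₅≡1 with first≡1⇒rest≡0 at-u₄ u₁u₄≡1 | first≡1⇒rest≡0 at-v₅ v₁v₅≡1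
    ... | u₄v₄≡0 , _ | v₄v₅≡0 , _ = rest≡0⇒first≡1 at-v₄ v₄v₅≡0 u₄v₄≡0

  hub-degree-split : hub-degree ≡ (u₁u₃ * v₁v₂ + u₁u₃ * v₁v₅) + (u₁u₄ * v₁v₂ + u₁u₄ * v₁v₅)
  hub-degree-split = begin
    hub-degree                                   ≡⟨ bit-square at-u₁ ⟨
    hub-degree * hub-degree                      ≡⟨ cong (hub-degree *_) v₁-follows-hub ⟨
    (u₁u₃ + u₁u₄) * (v₁v₂ + v₁v₅)                ≡⟨ expand u₁u₃ u₁u₄ v₁v₂ v₁v₅ ⟩
    (u₁u₃ * v₁v₂ + u₁u₃ * v₁v₅) + (u₁u₄ * v₁v₂ + u₁u₄ * v₁v₅) ∎
    where
    open ≡-Reasoning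
    bit-square : ∀ {n} → n ≤ 1 → n * n ≡ n
    bit-square z≤n       = refl
    bit-square (s≤s z≤n) = refl
    expand : ∀ a b c d → (a + b) * (c + d) ≡ (a * c + a * d) + (b * c + b * d)
    expand = solve-∀

  v₁-degree≤1 : v₁v₂ + v₁v₅ ≤ 1
  v₁-degree≤1 = subst (_≤ 1) (sym v₁-follows-hub) at-u₁

private
  four-types : ∀ k a b c d → a + b ≤ k → c + d ≤ suc k → a + c ≤ k → b + d ≤ suc k →
    b + c ≤ 1 → a + d ≤ k + k → a + b + (c + d) ≤ k + k
  four-types k a 0 0 d _ _ _ _ _ a+d≤2k rewrite +-identityʳ a = a+d≤2k
  four-types k a 1 0 d a+1≤k _ _ (s≤s d≤k) _ _ = +-mono-≤ a+1≤k d≤k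
  four-types k a 0 1 d _ (s≤s d≤k) a+1≤k _ _ _ =
    subst (_≤ k + k) (shift a d) (+-mono-≤ a+1≤k d≤k)
    where
    shift : ∀ a d → a + 1 + d ≡ a + 0 + (1 + d)
    shift = solve-∀
  four-types k a (suc (suc _)) c d _ _ _ _ (s≤s ())
  four-types k a 1 (suc _) d _ _ _ _ (s≤s ())
  four-types k a 0 (suc (suc _)) d _ _ _ _ (s≤s ())

  ∑-pair-bound : ∀ {m B} (f g t : Fin m → ℕ) → (∀ j → f j + g j ≤ t j) → ∑[ j < m ] t j ≤ B →
    ∑[ j < m ] f j + ∑[ j < m ] g j ≤ B
  ∑-pair-bound f g t f+g≤t ∑t≤B = ≤-trans (≤-reflexive (sym (∑-distrib-+ f g))) (≤-trans (∑-mono-≤ f+g≤t) ∑t≤B)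

open PetersenMatching

hub-visits-bound : ∀ {m} k (R : Fin m → PetersenMatching) →
  ∑[ j < m ] u₁u₃ (R j) ≤ k → ∑[ j < m ] u₁u₄ (R j) ≤ suc k →
  ∑[ j < m ] v₁v₂ (R j) ≤ k → ∑[ j < m ] v₁v₅ (R j) ≤ suc k →
  ∑[ j < m ] u₂u₅ (R j) ≤ 1 → ∑[ j < m ] v₃v₄ (R j) ≤ k + k →
  ∑[ j < m ] hub-degree (R j) ≤ k + k
hub-visits-bound {m} k R cap-u₁u₃ cap-u₁u₄ cap-v₁v₂ cap-v₁v₅ cap-u₂u₅ cap-v₃v₄ = begin
  ∑[ j < m ] hub-degree (R j)
    ≡⟨ sum-cong-≗ (λ j → hub-degree-split (R j)) ⟩
  ∑[ j < m ] ((n₃₂ j + n₃₅ j) + (n₄₂ j + n₄₅ j))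
    ≡⟨ ∑-distrib-+ (λ j → n₃₂ j + n₃₅ j) (λ j → n₄₂ j + n₄₅ j) ⟩
  ∑[ j < m ] (n₃₂ j + n₃₅ j) + ∑[ j < m ] (n₄₂ j + n₄₅ j)
    ≡⟨ cong₂ _+_ (∑-distrib-+ n₃₂ n₃₅) (∑-distrib-+ n₄₂ n₄₅) ⟩
  N₃₂ + N₃₅ + (N₄₂ + N₄₅)
    ≤⟨ four-types k N₃₂ N₃₅ N₄₂ N₄₅
         (∑-pair-bound n₃₂ n₃₅ (u₁u₃ ∘ R) (λ j → x*y+x*y′≤x (u₁u₃ (R j)) (v₁-degree≤1 (R j))) cap-u₁u₃)
         (∑-pair-bound n₄₂ n₄₅ (u₁u₄ ∘ R) (λ j → x*y+x*y′≤x (u₁u₄ (R j)) (v₁-degree≤1 (R j))) cap-u₁u₄)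
         (∑-pair-bound n₃₂ n₄₂ (v₁v₂ ∘ R) (covered-once-at-u₁ v₁v₂) cap-v₁v₂)
         (∑-pair-bound n₃₅ n₄₅ (v₁v₅ ∘ R) (covered-once-at-u₁ v₁v₅) cap-v₁v₅)
         (∑-pair-bound n₃₅ n₄₂ (u₂u₅ ∘ R) (λ j → crossing-bound (R j)) cap-u₂u₅)
         (∑-pair-bound n₃₂ n₄₅ (v₃v₄ ∘ R) (λ j → parallel-bound (R j)) cap-v₃v₄) ⟩
  k + k ∎
  where
  open ≤-Reasoning
  covered-once-at-u₁ : ∀ (f : PetersenMatching → ℕ) j → u₁u₃ (R j) * f (R j) + u₁u₄ (R j) * f (R j) ≤ f (R j)
  covered-once-at-u₁ f j = x*y+x′*y≤y (u₁u₃ (R j)) (u₁u₄ (R j)) (f (R j)) (at-u₁ (R j))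
  n₃₂ n₃₅ n₄₂ n₄₅ : Fin m → ℕ
  n₃₂ j = u₁u₃ (R j) * v₁v₂ (R j)
  n₃₅ j = u₁u₃ (R j) * v₁v₅ (R j)
  n₄₂ j = u₁u₄ (R j) * v₁v₂ (R j)
  n₄₅ j = u₁u₄ (R j) * v₁v₅ (R j)
  N₃₂ N₃₅ N₄₂ N₄₅ : ℕ
  N₃₂ = ∑[ j < m ] n₃₂ j
  N₃₅ = ∑[ j < m ] n₃₅ j
  N₄₂ = ∑[ j < m ] n₄₂ j
  N₄₅ = ∑[ j < m ] n₄₅ j

-- Multiplicities and adjacency in Q_k

v₁ v₂ v₃ v₄ v₅ u₂ u₃ u₄ u₅ : Fin 2 → QV
v₁ c = vv c 0F
v₂ c = vv c 1F
v₃ c = vv c 2F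
v₄ c = vv c 3F
v₅ c = vv c 4F
u₂ c = uu c 0F
u₃ c = uu c 1F
u₄ c = uu c 2F
u₅ c = uu c 3F

-- QkEdges k unfolds to copyEdges 0F (PkEdges k) ++ (copyEdges 1F (PkEdges k) ++ []).
copyEdges : Fin 2 → List (Edge PV) → List (Edge QV)
copyEdges c L = map (λ e → toQ c (proj₁ e) , toQ c (proj₂ e)) (filter (λ e → not (isU₁V₁ e) Bool.≟ true) L)

edgesQ : List (Edge PV) → QV → QV → ℕ
edgesQ L x y = countPairs (copyEdges 0F L) x y + countPairs (copyEdges 1F L) x y

countPairs-++ : ∀ xs ys x y → countPairs (xs ++ ys) x y ≡ countPairs xs x y + countPairs ys x y
countPairs-++ []             ys x y = refl
countPairs-++ ((a , b) ∷ xs) ys x y rewrite countPairs-++ xs ys x y =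
  sym (+-assoc (if (a ==Q x ∧ b ==Q y) ∨ (a ==Q y ∧ b ==Q x) then 1 else 0) (countPairs xs x y) (countPairs ys x y))

copyEdges-++ : ∀ c xs ys → copyEdges c (xs ++ ys) ≡ copyEdges c xs ++ copyEdges c ys
copyEdges-++ c xs ys = trans (cong (map copy) (filter-++ (λ e → not (isU₁V₁ e) Bool.≟ true) xs ys))
                             (map-++ copy (filter (λ e → not (isU₁V₁ e) Bool.≟ true) xs) _)
  where
  copy : Edge PV → Edge QV
  copy e = toQ c (proj₁ e) , toQ c (proj₂ e)

edgesQ-++ : ∀ xs ys x y → edgesQ (xs ++ ys) x y ≡ edgesQ xs x y + edgesQ ys x y
edgesQ-++ xs ys x y = begin
  edgesQ (xs ++ ys) x y
    ≡⟨ cong₂ _+_ (in-copy 0F) (in-copy 1F) ⟩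
  (countPairs (copyEdges 0F xs) x y + countPairs (copyEdges 0F ys) x y)
    + (countPairs (copyEdges 1F xs) x y + countPairs (copyEdges 1F ys) x y)
    ≡⟨ interchange (countPairs (copyEdges 0F xs) x y) _ _ (countPairs (copyEdges 1F ys) x y) ⟩
  edgesQ xs x y + edgesQ ys x y ∎
  where
  open ≡-Reasoning
  in-copy : ∀ c → countPairs (copyEdges c (xs ++ ys)) x y
                ≡ countPairs (copyEdges c xs) x y + countPairs (copyEdges c ys) x y
  in-copy c = trans (cong (λ es → countPairs es x y) (copyEdges-++ c xs ys))
                    (countPairs-++ (copyEdges c xs) (copyEdges c ys) x y)
  interchange : ∀ a b c d → (a + b) + (c + d) ≡ (a + c) + (b + d)
  interchange = solve-∀

edgesQ-replicate : ∀ n L x y → edgesQ (concat (replicate n L)) x y ≡ n * edgesQ L x y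
edgesQ-replicate zero    L x y = refl
edgesQ-replicate (suc n) L x y =
  trans (edgesQ-++ L (concat (replicate n L)) x y) (cong (edgesQ L x y +_) (edgesQ-replicate n L x y))

multQ≡ : ∀ k x y → multQ k x y
  ≡ edgesQ Pedges x y + k * edgesQ (M₀ ++ Mi i₁ ++ Mi i₂) x y + (k ∸ 1) * edgesQ (Mi i₅) x y
multQ≡ k x y = begin
  multQ k x y
    ≡⟨ countPairs-++ (copyEdges 0F (PkEdges k)) (copyEdges 1F (PkEdges k) ++ []) x y ⟩
  countPairs (copyEdges 0F (PkEdges k)) x y + countPairs (copyEdges 1F (PkEdges k) ++ []) x y
    ≡⟨ cong (countPairs (copyEdges 0F (PkEdges k)) x y +_)
            (trans (countPairs-++ (copyEdges 1F (PkEdges k)) [] x y) (+-identityʳ _)) ⟩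
  edgesQ (PkEdges k) x y
    ≡⟨ edgesQ-++ Pedges (Mk ++ M₅k) x y ⟩
  edgesQ Pedges x y + edgesQ (Mk ++ M₅k) x y
    ≡⟨ cong (edgesQ Pedges x y +_) (trans (edgesQ-++ Mk M₅k x y)
         (cong₂ _+_ (edgesQ-replicate k _ x y) (edgesQ-replicate (k ∸ 1) _ x y))) ⟩
  edgesQ Pedges x y + (k * edgesQ (M₀ ++ Mi i₁ ++ Mi i₂) x y + (k ∸ 1) * edgesQ (Mi i₅) x y)
    ≡⟨ +-assoc (edgesQ Pedges x y) _ _ ⟨
  edgesQ Pedges x y + k * edgesQ (M₀ ++ Mi i₁ ++ Mi i₂) x y + (k ∸ 1) * edgesQ (Mi i₅) x y ∎
  where
  open ≡-Reasoning
  Mk M₅k : List (Edge PV)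
  Mk = concat (replicate k (M₀ ++ Mi i₁ ++ Mi i₂))
  M₅k = concat (replicate (k ∸ 1) (Mi i₅))

private
  k-edges : ∀ k → 1 + suc k * 0 + k * 1 ≡ suc k
  k-edges = solve-∀
  k+1-edges : ∀ k → 1 + suc k * 1 + k * 0 ≡ suc (suc k)
  k+1-edges = solve-∀
  one-edge : ∀ k → 1 + suc k * 0 + k * 0 ≡ 1
  one-edge = solve-∀
  2k-edges : ∀ k → 1 + suc k * 1 + k * 1 ≡ suc k + suc k
  2k-edges = solve-∀

multQ-u₁u₃ : ∀ c k → multQ (suc k) hub (u₃ c) ≡ suc k
multQ-u₁u₃ 0F k = trans (multQ≡ (suc k) hub (u₃ 0F)) (k-edges k)
multQ-u₁u₃ 1F k = trans (multQ≡ (suc k) hub (u₃ 1F)) (k-edges k)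

multQ-u₁u₄ : ∀ c k → multQ (suc k) hub (u₄ c) ≡ suc (suc k)
multQ-u₁u₄ 0F k = trans (multQ≡ (suc k) hub (u₄ 0F)) (k+1-edges k)
multQ-u₁u₄ 1F k = trans (multQ≡ (suc k) hub (u₄ 1F)) (k+1-edges k)

multQ-v₁v₂ : ∀ c k → multQ (suc k) (v₁ c) (v₂ c) ≡ suc k
multQ-v₁v₂ 0F k = trans (multQ≡ (suc k) (v₁ 0F) (v₂ 0F)) (k-edges k)
multQ-v₁v₂ 1F k = trans (multQ≡ (suc k) (v₁ 1F) (v₂ 1F)) (k-edges k)

multQ-v₁v₅ : ∀ c k → multQ (suc k) (v₁ c) (v₅ c) ≡ suc (suc k)
multQ-v₁v₅ 0F k = trans (multQ≡ (suc k) (v₁ 0F) (v₅ 0F)) (k+1-edges k)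
multQ-v₁v₅ 1F k = trans (multQ≡ (suc k) (v₁ 1F) (v₅ 1F)) (k+1-edges k)

multQ-u₂u₅ : ∀ c k → multQ (suc k) (u₂ c) (u₅ c) ≡ 1
multQ-u₂u₅ 0F k = trans (multQ≡ (suc k) (u₂ 0F) (u₅ 0F)) (one-edge k)
multQ-u₂u₅ 1F k = trans (multQ≡ (suc k) (u₂ 1F) (u₅ 1F)) (one-edge k)

multQ-v₃v₄ : ∀ c k → multQ (suc k) (v₃ c) (v₄ c) ≡ suc k + suc k
multQ-v₃v₄ 0F k = trans (multQ≡ (suc k) (v₃ 0F) (v₄ 0F)) (2k-edges k)
multQ-v₃v₄ 1F k = trans (multQ≡ (suc k) (v₃ 1F) (v₄ 1F)) (2k-edges k)

-- Adjacency in Q_k does not depend on k ≥ 1; deciding it on Q₂ keeps it computable.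
adjacentᵇ : QV → QV → Bool
adjacentᵇ x y = 0 <ᵇ multQ 2 x y

nonadjacent⇒multQ≡0 : ∀ k x y → adjacentᵇ x y ≡ false → multQ k x y ≡ 0
nonadjacent⇒multQ≡0 k x y nonadjacent = begin
  multQ k x y          ≡⟨ multQ≡ k x y ⟩
  p + k * q + (k ∸ 1) * r ≡⟨ cong₂ (λ a b → a + k * b + (k ∸ 1) * r) p≡0 q≡0 ⟩
  0 + k * 0 + (k ∸ 1) * r ≡⟨ cong₂ (λ a b → a + (k ∸ 1) * b) (*-zeroʳ k) r≡0 ⟩
  (k ∸ 1) * 0            ≡⟨ *-zeroʳ (k ∸ 1) ⟩
  0 ∎
  where
  open ≡-Reasoning
  p q r : ℕ
  p = edgesQ Pedges x y
  q = edgesQ (M₀ ++ Mi i₁ ++ Mi i₂) x y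
  r = edgesQ (Mi i₅) x y
  zero-in-Q₂ : p + 2 * q + 1 * r ≡ 0
  zero-in-Q₂ = trans (sym (multQ≡ 2 x y)) (<ᵇ-false (multQ 2 x y) nonadjacent)
    where
    <ᵇ-false : ∀ n → (0 <ᵇ n) ≡ false → n ≡ 0
    <ᵇ-false zero _ = refl
  p≡0 : p ≡ 0
  p≡0 = m+n≡0⇒m≡0 p (m+n≡0⇒m≡0 (p + 2 * q) zero-in-Q₂)
  q≡0 : q ≡ 0
  q≡0 = m+n≡0⇒m≡0 q (m+n≡0⇒n≡0 p (m+n≡0⇒m≡0 (p + 2 * q) zero-in-Q₂))
  r≡0 : r ≡ 0
  r≡0 = m+n≡0⇒m≡0 r (m+n≡0⇒n≡0 (p + 2 * q) zero-in-Q₂)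

neighbours : QV → List QV
neighbours hub       = u₃ 0F ∷ u₄ 0F ∷ u₃ 1F ∷ u₄ 1F ∷ []
neighbours (vv c 0F) = v₂ c ∷ v₅ c ∷ []
neighbours (vv c 1F) = v₁ c ∷ v₃ c ∷ u₂ c ∷ []
neighbours (vv c 2F) = v₂ c ∷ v₄ c ∷ u₃ c ∷ []
neighbours (vv c 3F) = v₃ c ∷ v₅ c ∷ u₄ c ∷ []
neighbours (vv c 4F) = v₁ c ∷ v₄ c ∷ u₅ c ∷ []
neighbours (uu c 0F) = v₂ c ∷ u₄ c ∷ u₅ c ∷ []
neighbours (uu c 1F) = hub ∷ v₃ c ∷ u₅ c ∷ []
neighbours (uu c 2F) = hub ∷ v₄ c ∷ u₂ c ∷ []
neighbours (uu c 3F) = v₅ c ∷ u₂ c ∷ u₃ c ∷ []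

neighbours-correct : ∀ x → filterᵇ (adjacentᵇ x) allQV ≡ neighbours x
neighbours-correct hub        = refl
neighbours-correct (vv 0F 0F) = refl
neighbours-correct (vv 0F 1F) = refl
neighbours-correct (vv 0F 2F) = refl
neighbours-correct (vv 0F 3F) = refl
neighbours-correct (vv 0F 4F) = refl
neighbours-correct (vv 1F 0F) = refl
neighbours-correct (vv 1F 1F) = refl
neighbours-correct (vv 1F 2F) = refl
neighbours-correct (vv 1F 3F) = refl
neighbours-correct (vv 1F 4F) = refl
neighbours-correct (uu 0F 0F) = refl
neighbours-correct (uu 0F 1F) = refl
neighbours-correct (uu 0F 2F) = refl
neighbours-correct (uu 0F 3F) = refl
neighbours-correct (uu 1F 0F) = refl
neighbours-correct (uu 1F 1F) = refl
neighbours-correct (uu 1F 2F) = refl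
neighbours-correct (uu 1F 3F) = refl

private
  halves : ∀ {a b n} → a + b ≡ n + n → a ≤ n → b ≤ n → a ≡ n
  halves {a} {b} {n} a+b≡2n a≤n b≤n =
    ≤-antisym a≤n (+-cancelʳ-≤ n n a (≤-trans (≤-reflexive (sym a+b≡2n)) (+-monoʳ-≤ a b≤n)))

-- The lemma for Q (suc k): the theorem's k is suc k here.
module QInG (k : ℕ) (G : Graph) (φ : QV → Fin (nV G))
  (φ-injective : ∀ x y → φ x ≡ φ y → x ≡ y)
  (induced : ∀ x y → multG G (φ x) (φ y) ≡ multQ (suc k) x y)
  (Ns : Fin (4 * suc k) → Subset (nE G))
  (perfect : ∀ i → IsPerfectMatching G (Ns i))
  (disjoint : ∀ i j → i ≢ j → ∀ e → e ∈ Ns i → e ∉ Ns j)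
  (∂X≡ : boundary G (imageQ G φ) ≡ starOut G (φ (v₁ 0F)) (imageQ G φ) ∪ starOut G (φ (v₁ 1F)) (imageQ G φ))
  where

  open Embedding G φ φ-injective

  m : ℕ
  m = 4 * suc k

  meets : Fin m → QV → QV → ℕ
  meets j x y = ∣ Ns j ∩ edgesBetween G (φ x) (φ y) ∣

  meets-comm : ∀ j x y → meets j x y ≡ meets j y x
  meets-comm j x y = ∣∩edgesBetween∣-comm G (Ns j) (φ x) (φ y)

  exits : Fin m → Fin 2 → ℕ
  exits j c = ∣ Ns j ∩ starOut G (φ (v₁ c)) X ∣

  ∑meets≤multQ : ∀ x y → ∑[ j < m ] meets j x y ≤ multQ (suc k) x y
  ∑meets≤multQ x y = begin
    ∑[ j < m ] meets j x y                       ≡⟨ ∑∣∩∣-disjoint Ns disjoint (edgesBetween G (φ x) (φ y)) ⟩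
    ∣ ⋃ (tabulate Ns) ∩ edgesBetween G (φ x) (φ y) ∣ ≤⟨ ∣p∩q∣≤∣q∣ (⋃ (tabulate Ns)) (edgesBetween G (φ x) (φ y)) ⟩
    multG G (φ x) (φ y)                          ≡⟨ induced x y ⟩
    multQ (suc k) x y                            ∎
    where open ≤-Reasoning

  degree-equation : ∀ j x → ListSum.sum (map (meets j x) (neighbours x)) + ∣ Ns j ∩ starOut G (φ x) X ∣ ≡ 1
  degree-equation j x = begin
    ListSum.sum (map (meets j x) (neighbours x)) + ∣ Ns j ∩ starOut G (φ x) X ∣
      ≡⟨ cong (λ ys → ListSum.sum (map (meets j x) ys) + ∣ Ns j ∩ starOut G (φ x) X ∣) (neighbours-correct x) ⟨
    ListSum.sum (map (meets j x) (filterᵇ (adjacentᵇ x) allQV)) + ∣ Ns j ∩ starOut G (φ x) X ∣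
      ≡⟨ cong (_+ ∣ Ns j ∩ starOut G (φ x) X ∣) (sum-map-filterᵇ (adjacentᵇ x) (meets j x) allQV nonadjacent) ⟨
    ListSum.sum (map (meets j x) allQV) + ∣ Ns j ∩ starOut G (φ x) X ∣
      ≡⟨ degree-split (Ns j) (φ x) ⟨
    ∣ Ns j ∩ incident G (φ x) ∣
      ≡⟨ perfect j (φ x) ⟩
    1 ∎
    where
    open ≡-Reasoning
    nonadjacent : ∀ y → adjacentᵇ x y ≡ false → meets j x y ≡ 0
    nonadjacent y x≁y = n≤0⇒n≡0 (≤-trans (term≤∑ (λ j → meets j x y) j)
      (≤-trans (∑meets≤multQ x y) (≤-reflexive (nonadjacent⇒multQ≡0 (suc k) x y x≁y))))

  interior-equation : ∀ j x → x ≢ v₁ 0F → x ≢ v₁ 1F → ListSum.sum (map (meets j x) (neighbours x)) ≡ 1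
  interior-equation j x x≢v₁⁰ x≢v₁¹ = begin
    ListSum.sum (map (meets j x) (neighbours x))
      ≡⟨ +-identityʳ _ ⟨
    ListSum.sum (map (meets j x) (neighbours x)) + 0
      ≡⟨ cong (ListSum.sum (map (meets j x) (neighbours x)) +_)
              (starOut-vanishes ∂X≡ x (x≢v₁⁰ ∘ φ-injective x (v₁ 0F)) (x≢v₁¹ ∘ φ-injective x (v₁ 1F)) (Ns j)) ⟨
    ListSum.sum (map (meets j x) (neighbours x)) + ∣ Ns j ∩ starOut G (φ x) X ∣
      ≡⟨ degree-equation j x ⟩
    1 ∎
    where open ≡-Reasoning

  hub-meets : Fin m → Fin 2 → ℕ
  hub-meets j c = meets j hub (u₃ c) + meets j hub (u₄ c)

  hub-equation : ∀ j → hub-meets j 0F + hub-meets j 1F ≡ 1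
  hub-equation j =
    trans (regroup (meets j hub (u₃ 0F)) (meets j hub (u₄ 0F)) (meets j hub (u₃ 1F)) (meets j hub (u₄ 1F)))
          (interior-equation j hub (λ ()) (λ ()))
    where
    regroup : ∀ a b c d → (a + b) + (c + d) ≡ a + (b + (c + (d + 0)))
    regroup = solve-∀

  hub-bound : ∀ j c → hub-meets j c ≤ 1
  hub-bound j 0F = ≤-trans (m≤m+n (hub-meets j 0F) (hub-meets j 1F)) (≤-reflexive (hub-equation j))
  hub-bound j 1F = ≤-trans (m≤n+m (hub-meets j 1F) (hub-meets j 0F)) (≤-reflexive (hub-equation j))

  restrict : Fin m → Fin 2 → PetersenMatching
  restrict j c = record
    { u₁u₃ = meets j hub (u₃ c)
    ; u₁u₄ = meets j hub (u₄ c)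
    ; v₁v₂ = meets j (v₁ c) (v₂ c)
    ; v₁v₅ = meets j (v₁ c) (v₅ c)
    ; v₂v₃ = meets j (v₂ c) (v₃ c)
    ; v₃v₄ = meets j (v₃ c) (v₄ c)
    ; v₄v₅ = meets j (v₄ c) (v₅ c)
    ; u₂v₂ = meets j (v₂ c) (u₂ c)
    ; u₃v₃ = meets j (v₃ c) (u₃ c)
    ; u₄v₄ = meets j (v₄ c) (u₄ c)
    ; u₅v₅ = meets j (v₅ c) (u₅ c)
    ; u₂u₄ = meets j (u₂ c) (u₄ c)
    ; u₂u₅ = meets j (u₂ c) (u₅ c)
    ; u₃u₅ = meets j (u₃ c) (u₅ c)
    ; v₁-out = exits j c
    ; at-v₁ = trans (cong (λ n → meets j (v₁ c) (v₂ c) + n + exits j c) (sym (+-identityʳ _)))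
                    (degree-equation j (v₁ c))
    ; at-v₂ = reorient (comm (v₁ c) (v₂ c)) refl refl (interior-equation j (v₂ c) (λ ()) (λ ()))
    ; at-v₃ = reorient (comm (v₂ c) (v₃ c)) refl refl (interior-equation j (v₃ c) (λ ()) (λ ()))
    ; at-v₄ = reorient (comm (v₃ c) (v₄ c)) refl refl (interior-equation j (v₄ c) (λ ()) (λ ()))
    ; at-v₅ = reorient (comm (v₁ c) (v₅ c)) (comm (v₄ c) (v₅ c)) refl
                       (interior-equation j (v₅ c) (λ ()) (λ ()))
    ; at-u₂ = reorient (comm (v₂ c) (u₂ c)) refl refl (interior-equation j (u₂ c) (λ ()) (λ ()))
    ; at-u₃ = reorient (comm hub (u₃ c)) (comm (v₃ c) (u₃ c)) refl (interior-equation j (u₃ c) (λ ()) (λ ()))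
    ; at-u₄ = reorient (comm hub (u₄ c)) (comm (v₄ c) (u₄ c)) (comm (u₂ c) (u₄ c))
                       (interior-equation j (u₄ c) (λ ()) (λ ()))
    ; at-u₅ = reorient (comm (v₅ c) (u₅ c)) (comm (u₂ c) (u₅ c)) (comm (u₃ c) (u₅ c))
                       (interior-equation j (u₅ c) (λ ()) (λ ()))
    ; at-u₁ = hub-bound j c
    }
    where
    comm : ∀ x y → meets j x y ≡ meets j y x
    comm = meets-comm j
    reorient : ∀ {x y z x′ y′ z′} → x′ ≡ x → y′ ≡ y → z′ ≡ z → x + (y + (z + 0)) ≡ 1 → x′ + y′ + z′ ≡ 1
    reorient {x} {y} {z} refl refl refl eq rewrite +-identityʳ z = trans (+-assoc x y z) eq

  visits : Fin 2 → ℕ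
  visits c = ∑[ j < m ] hub-meets j c

  visits≤ : ∀ c → visits c ≤ suc k + suc k
  visits≤ c = hub-visits-bound (suc k) (λ j → restrict j c)
    (capacity hub (u₃ c) (multQ-u₁u₃ c k)) (capacity hub (u₄ c) (multQ-u₁u₄ c k))
    (capacity (v₁ c) (v₂ c) (multQ-v₁v₂ c k)) (capacity (v₁ c) (v₅ c) (multQ-v₁v₅ c k))
    (capacity (u₂ c) (u₅ c) (multQ-u₂u₅ c k)) (capacity (v₃ c) (v₄ c) (multQ-v₃v₄ c k))
    where
    capacity : ∀ x y {b} → multQ (suc k) x y ≡ b → ∑[ j < m ] meets j x y ≤ b
    capacity x y multQ≡b = ≤-trans (∑meets≤multQ x y) (≤-reflexive multQ≡b)

  visits-total : visits 0F + visits 1F ≡ (suc k + suc k) + (suc k + suc k)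
  visits-total = begin
    visits 0F + visits 1F                       ≡⟨ ∑-distrib-+ (λ j → hub-meets j 0F) (λ j → hub-meets j 1F) ⟨
    ∑[ j < m ] (hub-meets j 0F + hub-meets j 1F) ≡⟨ sum-cong-≗ hub-equation ⟩
    ∑[ j < m ] 1                                ≡⟨ ∑-const-1 m ⟩
    4 * suc k                                   ≡⟨ four-times (suc k) ⟩
    (suc k + suc k) + (suc k + suc k)           ∎
    where
    open ≡-Reasoning
    four-times : ∀ n → 4 * n ≡ (n + n) + (n + n)
    four-times = solve-∀

  exits-count : ∀ c c′ → (∀ j → exits j c ≡ hub-meets j c′) →
    ∣ starOut G (φ (v₁ c)) X ∩ ⋃ (tabulate Ns) ∣ ≡ 2 * suc k
  exits-count c c′ exits≡ = begin
    ∣ starOut G (φ (v₁ c)) X ∩ ⋃ (tabulate Ns) ∣ ≡⟨ cong ∣_∣ (∩-comm (starOut G (φ (v₁ c)) X) (⋃ (tabulate Ns))) ⟩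
    ∣ ⋃ (tabulate Ns) ∩ starOut G (φ (v₁ c)) X ∣ ≡⟨ ∑∣∩∣-disjoint Ns disjoint (starOut G (φ (v₁ c)) X) ⟨
    ∑[ j < m ] exits j c                         ≡⟨ sum-cong-≗ exits≡ ⟩
    visits c′                                    ≡⟨ visits≡ c′ ⟩
    suc k + suc k                                ≡⟨ cong (suc k +_) (+-identityʳ (suc k)) ⟨
    2 * suc k                                    ∎
    where
    open ≡-Reasoning
    visits≡ : ∀ c → visits c ≡ suc k + suc k
    visits≡ 0F = halves visits-total (visits≤ 0F) (visits≤ 1F)
    visits≡ 1F = halves (trans (+-comm (visits 1F) (visits 0F)) visits-total) (visits≤ 1F) (visits≤ 0F)

  exits-opposite : ∀ j → exits j 0F ≡ hub-meets j 1F × exits j 1F ≡ hub-meets j 0F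
  exits-opposite j = +-cancelʳ-≡ (hub-meets j 0F) _ _ exit₀ , +-cancelʳ-≡ (hub-meets j 1F) _ _ exit₁
    where
    exit₀ : exits j 0F + hub-meets j 0F ≡ hub-meets j 1F + hub-meets j 0F
    exit₀ = trans (hub-or-exit (restrict j 0F))
                  (trans (sym (hub-equation j)) (+-comm (hub-meets j 0F) (hub-meets j 1F)))
    exit₁ : exits j 1F + hub-meets j 1F ≡ hub-meets j 0F + hub-meets j 1F
    exit₁ = trans (hub-or-exit (restrict j 1F)) (sym (hub-equation j))

lemma3p1 : (k : ℕ) → 1 ≤ k →
    (G : Graph) → (φ : QV → Fin (nV G)) → InducedQ k G φ →
    (Ns : Fin (4 * k) → Subset (nE G)) →
    (∀ i → IsPerfectMatching G (Ns i)) →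
    (∀ i j → i ≢ j → ∀ e → e ∈ Ns i → e ∉ Ns j) →
    boundary G (imageQ G φ)
      ≡ starOut G (φ (vv zero zero)) (imageQ G φ) ∪ starOut G (φ (vv (suc zero) zero)) (imageQ G φ) →
    (∣ starOut G (φ (vv zero zero)) (imageQ G φ) ∩ ⋃ (tabulate Ns) ∣ ≡ 2 * k)
    × (∣ starOut G (φ (vv (suc zero) zero)) (imageQ G φ) ∩ ⋃ (tabulate Ns) ∣ ≡ 2 * k)
lemma3p1 (suc k) _ G φ (φ-injective , induced) Ns perfect disjoint ∂X≡ =
  exits-count zero (suc zero) (proj₁ ∘ exits-opposite) , exits-count (suc zero) zero (proj₂ ∘ exits-opposite)
  where
  open QInG k G φ φ-injective induced Ns perfect disjoint ∂X≡
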